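{- Let $n \ge 1$ and $t \ge 1$ be integers, and let $\ell$ be a positive integer with $\ell \nmid n$ and $\ell \le (t+1)n$. Then there exists a zero-sum sequence over $\mathbb{Z}/n\mathbb{Z}$ of length $(1+t)n - \ell$ which contains no zero-sum subsequence of length $nt$.
   Context: A sequence over an abelian group is a finite sequence of elements (repetition allowed); a subsequence is obtained by selecting some of its terms, not necessarily consecutive; a sequence is zero-sum if the sum of its terms is $0$. -}

module Defs where

open import Data.Nat using (ℕ; _+_; _%_; NonZero)
open import Data.Fin using (Fin; toℕ)
open import Data.List using (List; map; length)
open import Data.Nat.ListAction using (sum)
open import Data.List.Relation.Binary.Sublist.Propositional using (_⊆_)
open import Data.Product using (_×_)
open import Relation.Binary.PropositionalEquality using (_≡_)
open import Relation.Nullary using (¬_)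

-- ℤ/nℤ is represented by Fin n (residues 0,…,n-1); the group sum of a
-- sequence is the residue mod n of the sum of representatives.
-- A sequence over ℤ/nℤ is a List (Fin n).
IsZeroSum : (n : ℕ) → .{{NonZero n}} → List (Fin n) → Set
IsZeroSum n s = sum (map toℕ s) % n ≡ 0

-- A subsequence (terms selected, not necessarily consecutive, order kept)
-- is a sublist in the sense of the standard library.
HasZeroSumSubseqOfLength : (n : ℕ) → .{{NonZero n}} → List (Fin n) → ℕ → Set
HasZeroSumSubseqOfLength n s k =
  Data.Product.∃ λ (T : List (Fin n)) → (T ⊆ s) × (length T ≡ k) × IsZeroSum n T

-- If ℓ > n the sequence is shorter than nt, so the all-zero sequence of that
-- length works trivially.  If ℓ ≤ n, write n = qℓ + r with 0 < r < ℓ (so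
-- q ≥ 1, ℓ ≥ 2) and put e = ℓ − r.  The sequence is
--      q^x (q+1)^y     with  x = nt − e,  y = qℓ,
-- of length x + y = (1+t)n − ℓ and sum (x+y)q + y = q(x+y+ℓ) = q(1+t)n ≡ 0.
-- A subsequence of length nt consists of i ≤ x copies of q and j ≤ y copies of
-- q+1, so its sum is ntq + j ≡ j (mod n); as j ≤ y = n − r < n it is zero-sum
-- only if j = 0, i.e. i = nt > x, which is impossible.
module Submission where

open import Defs
open import Data.Nat using (ℕ; zero; suc; >-nonZero; _+_; _*_; _∸_; _≤_; _<_; s≤s; NonZero; _/_; _%_; _≤?_)
open import Data.Nat.Properties
open import Data.Nat.DivMod using (m≡m%n+[m/n]*n; m%n<n; m<n⇒m%n≡m; [m+kn]%n≡m%n; m*n%n≡0)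
open import Data.Nat.Divisibility using (_∣_; m%n≡0⇒n∣m)
open import Data.Nat.ListAction using (sum)
open import Data.Nat.ListAction.Properties using (sum-++)
open import Data.Nat.Tactic.RingSolver using (solve-∀)
open import Data.Fin using (Fin; toℕ; fromℕ<)
open import Data.Fin.Properties using (toℕ-fromℕ<)
open import Data.List using (List; []; _∷_; _++_; length; map; replicate)
open import Data.List.Properties using (length-++; length-replicate; map-++)
open import Data.List.Relation.Binary.Sublist.Propositional using (_⊆_; []; _∷_; _∷ʳ_)
open import Data.List.Relation.Binary.Sublist.Heterogeneous.Properties using (length-mono-≤)
open import Data.Product using (Σ; ∃₂; _×_; _,_)
open import Relation.Binary.PropositionalEquality using (_≡_; refl; sym; trans; cong; cong₂; module ≡-Reasoning)
open import Relation.Nullary using (¬_; yes; no)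

⊆-replicate : ∀ {A : Set} {c : A} k {T : List A} → T ⊆ replicate k c → T ≡ replicate (length T) c
⊆-replicate zero    []         = refl
⊆-replicate (suc k) (_ ∷ʳ T⊆)  = ⊆-replicate k T⊆
⊆-replicate (suc k) (refl ∷ T⊆) = cong (_ ∷_) (⊆-replicate k T⊆)

⊆-++-split : ∀ {A : Set} (xs : List A) {ys T : List A} → T ⊆ xs ++ ys →
  ∃₂ λ T₁ T₂ → T ≡ T₁ ++ T₂ × T₁ ⊆ xs × T₂ ⊆ ys
⊆-++-split []       T⊆ = [] , _ , refl , [] , T⊆
⊆-++-split (x ∷ xs) (.x ∷ʳ T⊆) with ⊆-++-split xs T⊆
... | T₁ , T₂ , refl , T₁⊆ , T₂⊆ = T₁ , T₂ , refl , x ∷ʳ T₁⊆ , T₂⊆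
⊆-++-split (x ∷ xs) (refl ∷ T⊆) with ⊆-++-split xs T⊆
... | T₁ , T₂ , refl , T₁⊆ , T₂⊆ = x ∷ T₁ , T₂ , refl , refl ∷ T₁⊆ , T₂⊆

blocks : ∀ {n} → Fin n → Fin n → ℕ → ℕ → List (Fin n)
blocks a b x y = replicate x a ++ replicate y b

length-blocks : ∀ {n} (a b : Fin n) x y → length (blocks a b x y) ≡ x + y
length-blocks a b x y = begin
  length (replicate x a ++ replicate y b)            ≡⟨ length-++ (replicate x a) ⟩
  length (replicate x a) + length (replicate y b)    ≡⟨ cong₂ _+_ (length-replicate x) (length-replicate y) ⟩
  x + y                                              ∎
  where open ≡-Reasoning

sum-replicate : ∀ {n} k (c : Fin n) → sum (map toℕ (replicate k c)) ≡ k * toℕ c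
sum-replicate zero    c = refl
sum-replicate (suc k) c = cong (toℕ c +_) (sum-replicate k c)

sum-blocks : ∀ {n} (a b : Fin n) x y → sum (map toℕ (blocks a b x y)) ≡ x * toℕ a + y * toℕ b
sum-blocks a b x y = begin
  sum (map toℕ (replicate x a ++ replicate y b))
    ≡⟨ cong sum (map-++ toℕ (replicate x a) _) ⟩
  sum (map toℕ (replicate x a) ++ map toℕ (replicate y b))
    ≡⟨ sum-++ (map toℕ (replicate x a)) _ ⟩
  sum (map toℕ (replicate x a)) + sum (map toℕ (replicate y b))
    ≡⟨ cong₂ _+_ (sum-replicate x a) (sum-replicate y b) ⟩
  x * toℕ a + y * toℕ b
    ∎
  where open ≡-Reasoning

sum-blocks-consecutive : ∀ {n} (a b : Fin n) x y → toℕ b ≡ suc (toℕ a) →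
  sum (map toℕ (blocks a b x y)) ≡ (x + y) * toℕ a + y
sum-blocks-consecutive a b x y b≡a+1 = begin
  sum (map toℕ (blocks a b x y))   ≡⟨ sum-blocks a b x y ⟩
  x * toℕ a + y * toℕ b            ≡⟨ cong (λ v → x * toℕ a + y * v) b≡a+1 ⟩
  x * toℕ a + y * suc (toℕ a)      ≡⟨ regroup x y (toℕ a) ⟩
  (x + y) * toℕ a + y              ∎
  where
  open ≡-Reasoning
  regroup : ∀ x y q → x * q + y * suc q ≡ (x + y) * q + y
  regroup = solve-∀

⊆-blocks : ∀ {n} (a b : Fin n) x y {T} → T ⊆ blocks a b x y →
  ∃₂ λ i j → i ≤ x × j ≤ y × T ≡ blocks a b i j
⊆-blocks a b x y T⊆ with ⊆-++-split (replicate x a) T⊆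
... | T₁ , T₂ , refl , T₁⊆ , T₂⊆ =
  length T₁ , length T₂ ,
  ≤-trans (length-mono-≤ T₁⊆) (≤-reflexive (length-replicate x)) ,
  ≤-trans (length-mono-≤ T₂⊆) (≤-reflexive (length-replicate y)) ,
  cong₂ _++_ (⊆-replicate x T₁⊆) (⊆-replicate y T₂⊆)

no-long-subsequence : ∀ n .{{_ : NonZero n}} (s : List (Fin n)) m → length s < m →
  ¬ HasZeroSumSubseqOfLength n s m
no-long-subsequence n s m s<m (T , T⊆s , T≡m , _) =
  <⇒≱ s<m (≤-trans (≤-reflexive (sym T≡m)) (length-mono-≤ T⊆s))

-- In q^x (q+1)^y with y < n and x < nt every subsequence of length nt has sum
-- ntq + j ≡ j (mod n) with 0 ≤ j ≤ y < n, hence j = 0; but then it would need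
-- nt > x copies of q.
no-zero-sum-in-blocks : ∀ n t .{{_ : NonZero n}} (a b : Fin n) x y →
  toℕ b ≡ suc (toℕ a) → y < n → x < n * t →
  ¬ HasZeroSumSubseqOfLength n (blocks a b x y) (n * t)
no-zero-sum-in-blocks n t a b x y b≡a+1 y<n x<nt (T , T⊆ , lenT , zeroT)
  with ⊆-blocks a b x y T⊆
... | i , j , i≤x , j≤y , refl = <⇒≱ x<nt (≤-trans (≤-reflexive (sym i≡nt)) i≤x)
  where
  open ≡-Reasoning
  q = toℕ a
  i+j≡nt : i + j ≡ n * t
  i+j≡nt = trans (sym (length-blocks a b i j)) lenT
  j≡0 : j ≡ 0
  j≡0 = begin
    j                                     ≡⟨ sym (m<n⇒m%n≡m (≤-<-trans j≤y y<n)) ⟩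
    j % n                                 ≡⟨ sym ([m+kn]%n≡m%n j (t * q) n) ⟩
    (j + t * q * n) % n                   ≡⟨ cong (_% n) (reorder j n t q) ⟩
    ((n * t) * q + j) % n                 ≡⟨ cong (λ m → (m * q + j) % n) (sym i+j≡nt) ⟩
    ((i + j) * q + j) % n                 ≡⟨ cong (_% n) (sym (sum-blocks-consecutive a b i j b≡a+1)) ⟩
    sum (map toℕ (blocks a b i j)) % n    ≡⟨ zeroT ⟩
    0                                     ∎
    where
    reorder : ∀ j n t q → j + t * q * n ≡ (n * t) * q + j
    reorder = solve-∀
  i≡nt : i ≡ n * t
  i≡nt = trans (sym (+-identityʳ i)) (trans (cong (i +_) (sym j≡0)) i+j≡nt)

blocks-witness : ∀ n t ℓ .{{_ : NonZero n}} (a b : Fin n) x y →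
  toℕ b ≡ suc (toℕ a) → y ≡ toℕ a * ℓ → y < n → x < n * t → x + y + ℓ ≡ (1 + t) * n →
  (length (blocks a b x y) ≡ (1 + t) * n ∸ ℓ) × IsZeroSum n (blocks a b x y) ×
  ¬ HasZeroSumSubseqOfLength n (blocks a b x y) (n * t)
blocks-witness n t ℓ a b x y b≡a+1 y≡qℓ y<n x<nt total =
  length-ok , zero-sum , no-zero-sum-in-blocks n t a b x y b≡a+1 y<n x<nt
  where
  open ≡-Reasoning
  q = toℕ a
  length-ok : length (blocks a b x y) ≡ (1 + t) * n ∸ ℓ
  length-ok = begin
    length (blocks a b x y)   ≡⟨ length-blocks a b x y ⟩
    x + y                     ≡⟨ sym (m+n∸n≡m (x + y) ℓ) ⟩
    x + y + ℓ ∸ ℓ             ≡⟨ cong (_∸ ℓ) total ⟩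
    (1 + t) * n ∸ ℓ           ∎
  regroup : ∀ x y q ℓ → (x + y) * q + q * ℓ ≡ (x + y + ℓ) * q
  regroup = solve-∀
  reorder : ∀ t n q → (1 + t) * n * q ≡ ((1 + t) * q) * n
  reorder = solve-∀
  zero-sum : IsZeroSum n (blocks a b x y)
  zero-sum = begin
    sum (map toℕ (blocks a b x y)) % n   ≡⟨ cong (_% n) (sum-blocks-consecutive a b x y b≡a+1) ⟩
    ((x + y) * q + y) % n               ≡⟨ cong (λ v → ((x + y) * q + v) % n) y≡qℓ ⟩
    ((x + y) * q + q * ℓ) % n           ≡⟨ cong (_% n) (regroup x y q ℓ) ⟩
    ((x + y + ℓ) * q) % n               ≡⟨ cong (λ m → (m * q) % n) total ⟩
    ((1 + t) * n * q) % n               ≡⟨ cong (_% n) (reorder t n q) ⟩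
    ((1 + t) * q * n) % n               ≡⟨ m*n%n≡0 ((1 + t) * q) n ⟩
    0                                   ∎

-- The case ℓ ≤ n, given the division n = qℓ + r with 0 < r < ℓ: choose
-- x = nt − (ℓ − r) and y = qℓ, and realise q, q+1 as residues (q+1 < n
-- because q+1 ≤ 2q ≤ qℓ < n).
witness-from-division : ∀ n t ℓ q r .{{_ : NonZero n}} → 1 ≤ t → ℓ ≤ n →
  r + q * ℓ ≡ n → 1 ≤ r → r < ℓ →
  Σ (List (Fin n)) λ s →
    (length s ≡ (1 + t) * n ∸ ℓ) × IsZeroSum n s × ¬ HasZeroSumSubseqOfLength n s (n * t)
witness-from-division n t ℓ q r t≥1 ℓ≤n r+qℓ≡n r≥1 r<ℓ =
  blocks a b x y ,
  blocks-witness n t ℓ a b x y b≡a+1 y≡qℓ y<n x<nt total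
  where
  e x y : ℕ
  e = ℓ ∸ r
  x = n * t ∸ e
  y = q * ℓ
  r+e≡ℓ : r + e ≡ ℓ
  r+e≡ℓ = m+[n∸m]≡n (<⇒≤ r<ℓ)
  e≤nt : e ≤ n * t
  e≤nt = ≤-trans (m∸n≤m ℓ r) (≤-trans ℓ≤n (m≤m*n n t {{>-nonZero t≥1}}))
  x+e≡nt : x + e ≡ n * t
  x+e≡nt = m∸n+n≡m e≤nt
  x<nt : x < n * t
  x<nt = ∸-monoʳ-< (m<n⇒0<n∸m r<ℓ) e≤nt
  y<n : y < n
  y<n = ≤-trans (+-monoˡ-≤ y r≥1) (≤-reflexive r+qℓ≡n)
  total : x + y + ℓ ≡ (1 + t) * n
  total = begin
    x + y + ℓ               ≡⟨ cong (x + y +_) (sym r+e≡ℓ) ⟩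
    x + y + (r + e)         ≡⟨ regroup x y r e ⟩
    (x + e) + (r + y)       ≡⟨ cong₂ _+_ x+e≡nt r+qℓ≡n ⟩
    n * t + n               ≡⟨ +-comm (n * t) n ⟩
    n + n * t               ≡⟨ cong (n +_) (*-comm n t) ⟩
    (1 + t) * n             ∎
    where
    open ≡-Reasoning
    regroup : ∀ x y r e → x + y + (r + e) ≡ (x + e) + (r + y)
    regroup = solve-∀
  q≥1 : 1 ≤ q
  q≥1 = n≢0⇒n>0 λ q≡0 → <⇒≱ (<-≤-trans r<ℓ ℓ≤n)
    (≤-reflexive (trans (sym r+qℓ≡n) (trans (cong (λ m → r + m * ℓ) q≡0) (+-identityʳ r))))
  q+1≤y : suc q ≤ y
  q+1≤y = begin
    1 + q       ≤⟨ +-monoˡ-≤ q q≥1 ⟩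
    q + q       ≡⟨ cong (q +_) (sym (+-identityʳ q)) ⟩
    2 * q       ≡⟨ *-comm 2 q ⟩
    q * 2       ≤⟨ *-monoʳ-≤ q (≤-trans (s≤s r≥1) r<ℓ) ⟩
    q * ℓ       ∎
    where open ≤-Reasoning
  q+1<n : suc q < n
  q+1<n = ≤-<-trans q+1≤y y<n
  q<n : q < n
  q<n = <-trans (n<1+n q) q+1<n
  a b : Fin n
  a = fromℕ< q<n
  b = fromℕ< q+1<n
  b≡a+1 : toℕ b ≡ suc (toℕ a)
  b≡a+1 = trans (toℕ-fromℕ< q+1<n) (cong suc (sym (toℕ-fromℕ< q<n)))
  y≡qℓ : y ≡ toℕ a * ℓ
  y≡qℓ = cong (_* ℓ) (sym (toℕ-fromℕ< q<n))

-- The case ℓ > n: (1+t)n − ℓ < nt, so the all-zero sequence has no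
-- subsequence of length nt at all.
witness-for-large-ℓ : ∀ n t ℓ (n≥1 : 1 ≤ n) → n < ℓ → ℓ ≤ (t + 1) * n →
  Σ (List (Fin n)) λ s →
    (length s ≡ (1 + t) * n ∸ ℓ) × IsZeroSum n {{>-nonZero n≥1}} s ×
    ¬ HasZeroSumSubseqOfLength n {{>-nonZero n≥1}} s (n * t)
witness-for-large-ℓ n t ℓ n≥1 n<ℓ ℓ≤ =
  replicate L zero-residue , length-replicate L , zero-sum ,
  no-long-subsequence n {{>-nonZero n≥1}} _ (n * t) short
  where
  instance
    n≢0 : NonZero n
    n≢0 = >-nonZero n≥1
  L = (1 + t) * n ∸ ℓ
  zero-residue : Fin n
  zero-residue = fromℕ< n≥1
  zero-sum : IsZeroSum n (replicate L zero-residue)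
  zero-sum = begin
    sum (map toℕ (replicate L zero-residue)) % n   ≡⟨ cong (_% n) (sum-replicate L zero-residue) ⟩
    (L * toℕ zero-residue) % n                    ≡⟨ cong (λ v → (L * v) % n) (toℕ-fromℕ< n≥1) ⟩
    (L * 0) % n                                   ≡⟨ cong (_% n) (*-zeroʳ L) ⟩
    0 % n                                         ≡⟨ m<n⇒m%n≡m n≥1 ⟩
    0                                             ∎
    where open ≡-Reasoning
  short : length (replicate L zero-residue) < n * t
  short = begin-strict
    length (replicate L zero-residue)  ≡⟨ length-replicate L ⟩
    (1 + t) * n ∸ ℓ                    <⟨ ∸-monoʳ-< n<ℓ (≤-trans ℓ≤ (≤-reflexive (cong (_* n) (+-comm t 1)))) ⟩
    (1 + t) * n ∸ n                    ≡⟨ m+n∸m≡n n (t * n) ⟩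
    t * n                              ≡⟨ *-comm t n ⟩
    n * t                              ∎
    where open ≤-Reasoning

proposition2p3 : (n t ℓ : ℕ) → (n≥1 : 1 ≤ n) → 1 ≤ t → 1 ≤ ℓ → ¬ (ℓ ∣ n) → ℓ ≤ (t + 1) * n →
    Σ (List (Fin n)) λ s →
      (length s ≡ (1 + t) * n ∸ ℓ) × IsZeroSum n {{>-nonZero n≥1}} s × ¬ HasZeroSumSubseqOfLength n {{>-nonZero n≥1}} s (n * t)
proposition2p3 n t ℓ n≥1 t≥1 ℓ≥1 ℓ∤n ℓ≤ with ℓ ≤? n
... | no ℓ≰n = witness-for-large-ℓ n t ℓ n≥1 (≰⇒> ℓ≰n) ℓ≤
... | yes ℓ≤n =
  witness-from-division n t ℓ (n / ℓ) (n % ℓ) {{>-nonZero n≥1}} t≥1 ℓ≤n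
    (sym (m≡m%n+[m/n]*n n ℓ)) remainder≥1 (m%n<n n ℓ)
  where
  instance
    ℓ≢0 : NonZero ℓ
    ℓ≢0 = >-nonZero ℓ≥1
  remainder≥1 : 1 ≤ n % ℓ
  remainder≥1 = n≢0⇒n>0 λ r≡0 → ℓ∤n (m%n≡0⇒n∣m n ℓ r≡0)
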